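{- Let $\mathcal{G}_W=(L_1,L_2,l_0,X,\mathit{Act},\mathit{Obs},\mathit{flow},E,\mathit{lbl})$ be an initialized stopwatch game, let $\overline{\mathcal{G}_W}$ be the game with reset-memory described in the context, and let $\beta_1=\{((l,v),((l,f),v)) : (l,v)\in Q(\mathcal{G}_W),\ f\in F\}$. Then $\beta_1$ witnesses $T(\mathcal{G}_W)\preceq_s T(\overline{\mathcal{G}_W})$.
   Context: A simple compact constraint over a finite set $X$ of real variables is a conjunction containing, for each $x\in X$, exactly one conjunct $x\in I$ with $I$ a compact interval with rational endpoints; $\varphi(x)$ denotes that interval. An initialized singular game is a tuple $\mathcal{G}=(L_1,L_2,l_0,X,\mathit{Act},\mathit{Obs},\mathit{flow},E,\mathit{lbl})$ where $L_1,L_2$ are disjoint finite sets of locations (owned by Player 1 and Player 2 respectively), $l_0\in L_1$, $X$ is a finite set of real variables, $\mathit{Act}$ a finite set of actions, $\mathit{Obs}$ a finite set of observations, $\mathit{lbl}:L_1\cup L_2\to\mathit{Obs}$, $\mathit{flow}:(L_1\cup L_2)\times X\to\mathbb{Q}$, and $E$ is a set of edges $e=(l,a,\varphi_e,\mathit{rst}_e,l')$ with $l,l'\in L_1\cup L_2$, $a\in\mathit{Act}$, $\varphi_e$ a simple compact constraint over $X$, and $\mathit{rst}_e:X\to\mathbb{Q}\cup\{\bot\}$, such that $\mathit{flow}(l,x)\neq\mathit{flow}(l',x)$ implies $\mathit{rst}_e(x)\neq\bot$. An initialized stopwatch game is an initialized singular game with $\mathit{flow}(l,x)\in\{0,1\}$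 for all $l,x$. Semantics: the transition system $T(\mathcal{G})$ has configurations $Q(\mathcal{G})=(L_1\cup L_2)\times\mathbb{R}^X$, initial configuration $(l_0,\vec 0)$, moves $\mathit{Act}\times\mathbb{R}_{\ge 0}$, and a transition $(l,v)\xrightarrow{(a,t)}(l',v')$ whenever there is an edge $e=(l,a,\varphi_e,\mathit{rst}_e,l')$ such that for every $x\in X$: $v(x)+t\cdot\mathit{flow}(l,x)\in\varphi_e(x)$, and $v'(x)=\mathit{rst}_e(x)$ if $\mathit{rst}_e(x)\neq\bot$, $v'(x)=v(x)+t\cdot\mathit{flow}(l,x)$ otherwise. $Q_i(\mathcal{G})$ is the set of configurations whose location lies in $L_i$; $\mathit{lbl}$ is extended to configurations via their location. Alternating simulation: for two such games $\mathcal{G}^1,\mathcal{G}^2$ with the same observation set, a relation $R\subseteq (Q_1(\mathcal{G}^1)\times Q_1(\mathcal{G}^2))\cup(Q_2(\mathcal{G}^1)\times Q_2(\mathcal{G}^2))$ is a simulation if for every $(p,q)\in R$: (1) $\mathit{lbl}^1(p)=\mathit{lbl}^2(q)$; (2) if $p\in Q_1(\mathcal{G}^1)$, then for every move $m$ and every transition $p\xrightarrow{m}p'$ in $T(\mathcal{G}^1)$ there exist a move $m'$ and a transition $q\xrightarrow{m'}q'$ in $T(\mathcal{G}^2)$ with $(p',q')\in R$; (3) if $p\in Q_2(\mathcal{G}^1)$, then for every move $m'$ and every transition $q\xrightarrow{m'}q'$ in $T(\mathcal{G}^2)$ there exist a move $m$ and a transition $p\xrightarrow{m}p'$ in $T(\mathcal{G}^1)$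 with $(p',q')\in R$. $R$ witnesses $T(\mathcal{G}^1)\preceq_s T(\mathcal{G}^2)$ if $R$ is a simulation containing the pair of initial configurations. Construction of $\overline{\mathcal{G}_W}$: let $K$ be the set of constants used in $\mathcal{G}_W$ together with $0$, $K_\bot=K\cup\{\bot\}$, and $F$ the set of functions $f:X\to K_\bot$. Then $\overline{\mathcal{G}_W}=(\overline{L_1},\overline{L_2},\overline{l_0},X,\mathit{Act},\mathit{Obs},\overline{\mathit{flow}},\overline{E},\overline{\mathit{lbl}})$ with $\overline{L_i}=L_i\times F$, $\overline{l_0}=(l_0,f_0)$ where $f_0\equiv 0$, $\overline{\mathit{flow}}((l,f),x)=\mathit{flow}(l,x)$, $\overline{\mathit{lbl}}(l,f)=\mathit{lbl}(l)$, and $\overline{E}$ consists of all edges $((l_1,f_1),a,\varphi,\mathit{rst},(l_2,f_2))$ such that $(l_1,a,\varphi,\mathit{rst},l_2)\in E$, $f_1\in F$, and for every $x\in X$: $f_2(x)=\bot$ if $\mathit{flow}(l_2,x)=1$; $f_2(x)=\mathit{rst}(x)$ if $\mathit{flow}(l_2,x)=0$ and $\mathit{rst}(x)\neq\bot$; $f_2(x)=f_1(x)$ if $\mathit{flow}(l_2,x)=0$ and $\mathit{rst}(x)=\bot$. -}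

module Defs where

open import Data.Nat using (ℕ)
open import Data.Fin using (Fin)
open import Data.Rational using (ℚ; 0ℚ; 1ℚ) renaming (_≤_ to _≤ℚ_)
open import Data.Maybe using (Maybe; just; nothing)
open import Data.Maybe.Properties using (just-injective)
open import Data.Product using (Σ; _×_; _,_; proj₁; proj₂)
open import Data.Sum using (_⊎_; inj₁; inj₂)
open import Data.Unit using (⊤)
open import Data.Empty using (⊥)
open import Data.List using (List)
open import Data.List.Membership.Propositional using (_∈_)
open import Relation.Binary.PropositionalEquality using (_≡_; _≢_; sym)

-- A simple compact constraint over X: for each variable x a pair
-- (lower endpoint, upper endpoint) of rationals; the interval is
-- [lo, hi].  (Well-formedness lo ≤ hi is required by `GuardsCompact`.)

Constraint : Set → Set
Constraint X = X → ℚ × ℚ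

-- Reset functions X → ℚ ∪ {⊥}, with ⊥ = nothing.
Reset : Set → Set
Reset X = X → Maybe ℚ

record Edge (Loc X Act : Set) : Set where
  constructor mkEdge
  field
    src   : Loc
    act   : Act
    guard : Constraint X
    rst   : Reset X
    tgt   : Loc

open Edge public

record FinGame (nX nA nO : ℕ) : Set where
  field
    n₁ n₂ : ℕ
    l₀    : Fin n₁
    flow  : Fin n₁ ⊎ Fin n₂ → Fin nX → ℚ
    E     : List (Edge (Fin n₁ ⊎ Fin n₂) (Fin nX) (Fin nA))
    lbl   : Fin n₁ ⊎ Fin n₂ → Fin nO

  Loc : Set
  Loc = Fin n₁ ⊎ Fin n₂

module _ {nX nA nO : ℕ} (G : FinGame nX nA nO) where
  open FinGame G

  GuardsCompact : Set
  GuardsCompact = ∀ e → e ∈ E → ∀ x → proj₁ (guard e x) ≤ℚ proj₂ (guard e x)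

  IsInitialized : Set
  IsInitialized = ∀ e → e ∈ E → ∀ x →
    flow (src e) x ≢ flow (tgt e) x → rst e x ≢ nothing

  IsStopwatch : Set
  IsStopwatch = ∀ l x → (flow l x ≡ 0ℚ) ⊎ (flow l x ≡ 1ℚ)

  InK : ℚ → Set
  InK q = (q ≡ 0ℚ) ⊎ Σ (Edge Loc (Fin nX) (Fin nA)) λ e → e ∈ E × Σ (Fin nX) λ x →
            (q ≡ proj₁ (guard e x)) ⊎ (q ≡ proj₂ (guard e x)) ⊎ (rst e x ≡ just q)

  F : Set
  F = Σ (Fin nX → Maybe ℚ) λ f → ∀ x q → f x ≡ just q → InK q

  f₀ : F
  f₀ = (λ _ → just 0ℚ) , λ x q eq → inj₁ (sym (just-injective eq))

-- Agda's standard library has no reals;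
-- the statement is made for every carrier equipped with an embedding of
-- ℚ, addition, multiplication and an order (no axioms are assumed), which
-- in particular covers ℝ.

record RealLike : Set₁ where
  field
    Carrier : Set
    fromℚ   : ℚ → Carrier
    _+_     : Carrier → Carrier → Carrier
    _*_     : Carrier → Carrier → Carrier
    _≤_     : Carrier → Carrier → Set

record Game (X Act Obs : Set) : Set₁ where
  field
    L₁ L₂ : Set
    l₀    : L₁
    flow  : L₁ ⊎ L₂ → X → ℚ
    Edg   : L₁ ⊎ L₂ → Act → Constraint X → Reset X → L₁ ⊎ L₂ → Set
    lbl   : L₁ ⊎ L₂ → Obs

  Loc : Set
  Loc = L₁ ⊎ L₂

module Semantics (ℝ : RealLike) where
  open RealLike ℝ

  _∈I_ : Carrier → ℚ × ℚ → Set
  r ∈I (a , b) = (fromℚ a ≤ r) × (r ≤ fromℚ b)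

  update : Maybe ℚ → Carrier → Carrier
  update (just q) _ = fromℚ q
  update nothing  r = r

  module _ {X Act Obs : Set} (G : Game X Act Obs) where
    open Game G

    Conf : Set
    Conf = Loc × (X → Carrier)

    initConf : Conf
    initConf = inj₁ l₀ , λ _ → fromℚ 0ℚ

    Move : Set
    Move = Act × Σ Carrier (λ t → fromℚ 0ℚ ≤ t)

    Step : Conf → Move → Conf → Set
    Step (l , v) (a , t , _) (l' , v') =
      Σ (Constraint X) λ φ → Σ (Reset X) λ r →
        Edg l a φ r l'
        × (∀ x → (v x + (t * fromℚ (flow l x))) ∈I φ x)
        × (∀ x → v' x ≡ update (r x) (v x + (t * fromℚ (flow l x))))

    IsQ₁ : Conf → Set
    IsQ₁ (inj₁ _ , _) = ⊤
    IsQ₁ (inj₂ _ , _) = ⊥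

    IsQ₂ : Conf → Set
    IsQ₂ (inj₁ _ , _) = ⊥
    IsQ₂ (inj₂ _ , _) = ⊤

  module _ {X Act Obs : Set} (G¹ G² : Game X Act Obs) where
    open Game

    SameOwner : Conf G¹ → Conf G² → Set
    SameOwner p q = (IsQ₁ G¹ p × IsQ₁ G² q) ⊎ (IsQ₂ G¹ p × IsQ₂ G² q)

    IsSimulation : (Conf G¹ → Conf G² → Set) → Set
    IsSimulation R = ∀ p q → R p q →
        SameOwner p q
      × (lbl G¹ (proj₁ p) ≡ lbl G² (proj₁ q))
      × (IsQ₁ G¹ p → ∀ m p' → Step G¹ p m p' →
           Σ (Move G²) λ m' → Σ (Conf G²) λ q' → Step G² q m' q' × R p' q')
      × (IsQ₂ G¹ p → ∀ m' q' → Step G² q m' q' →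
           Σ (Move G¹) λ m → Σ (Conf G¹) λ p' → Step G¹ p m p' × R p' q')

    Witnesses : (Conf G¹ → Conf G² → Set) → Set
    Witnesses R = IsSimulation R × R (initConf G¹) (initConf G²)

module _ {nX nA nO : ℕ} (G : FinGame nX nA nO) where
  open FinGame G

  toGame : Game (Fin nX) (Fin nA) (Fin nO)
  toGame = record
    { L₁ = Fin n₁ ; L₂ = Fin n₂ ; l₀ = l₀ ; flow = flow
    ; Edg = λ l a φ r l' → mkEdge l a φ r l' ∈ E
    ; lbl = lbl }

  LocBar : Set
  LocBar = (Fin n₁ × F G) ⊎ (Fin n₂ × F G)

  base : LocBar → Loc
  base (inj₁ (l , _)) = inj₁ l
  base (inj₂ (l , _)) = inj₂ l

  mem : LocBar → Fin nX → Maybe ℚ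
  mem (inj₁ (_ , f)) = proj₁ f
  mem (inj₂ (_ , f)) = proj₁ f

  attach : Loc → F G → LocBar
  attach (inj₁ l) f = inj₁ (l , f)
  attach (inj₂ l) f = inj₂ (l , f)

  orElse : Maybe ℚ → Maybe ℚ → Maybe ℚ
  orElse (just q) _ = just q
  orElse nothing  m = m

  MemUpd : ℚ → Maybe ℚ → Maybe ℚ → Maybe ℚ → Set
  MemUpd fl r f₁ f₂ = (fl ≡ 1ℚ → f₂ ≡ nothing) × (fl ≡ 0ℚ → f₂ ≡ orElse r f₁)

  overline : Game (Fin nX) (Fin nA) (Fin nO)
  overline = record
    { L₁ = Fin n₁ × F G ; L₂ = Fin n₂ × F G ; l₀ = l₀ , f₀ G
    ; flow = λ l x → flow (base l) x
    ; Edg = λ l a φ r l' → (mkEdge (base l) a φ r (base l') ∈ E)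
              × (∀ x → MemUpd (flow (base l') x) (r x) (mem l x) (mem l' x))
    ; lbl = λ l → lbl (base l) }

  β₁ : (ℝ : RealLike) → Semantics.Conf ℝ toGame → Semantics.Conf ℝ overline → Set
  β₁ ℝ (l , v) (l̄ , w) = Σ (F G) λ f → (l̄ ≡ attach l f) × (w ≡ v)

-- Memory never blocks a move of the reset-memory game: Player 1's moves of G_W are copied
-- verbatim, choosing as successor memory the one dictated by the update rule (which is
-- total because stopwatch flows are 0 or 1), and Player 2's moves are projected back by
-- forgetting the memory.
module Submission where

open import Defs
open import Data.Nat using (ℕ)
open import Data.Fin using (Fin)
open import Data.Rational using (ℚ)
open import Data.Rational.Properties using (1≢0)
open import Data.Maybe using (Maybe; just; nothing)
open import Data.Product using (Σ; _×_; _,_; proj₁; proj₂)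
open import Data.Sum using (inj₁; inj₂)
open import Data.Unit using (tt)
open import Data.List.Membership.Propositional using (_∈_)
open import Relation.Binary.PropositionalEquality using (_≡_; refl; sym; trans)
open import Relation.Nullary using (contradiction)

module _ {nX nA nO : ℕ} (G : FinGame nX nA nO) (stopwatch : IsStopwatch G) where
  open FinGame G

  nextMemoryᶠ : Edge Loc (Fin nX) (Fin nA) → (Fin nX → Maybe ℚ) → Fin nX → Maybe ℚ
  nextMemoryᶠ e f x with stopwatch (tgt e) x
  ... | inj₁ _ = orElse G (rst e x) (f x)
  ... | inj₂ _ = nothing

  nextMemory-InK : ∀ {e} → e ∈ E → (f : F G) →
    ∀ x q → nextMemoryᶠ e (proj₁ f) x ≡ just q → InK G q
  nextMemory-InK {e} e∈E f x q eq with stopwatch (tgt e) x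
  ... | inj₁ _ with rst e x in rst≡
  ...   | just _  = inj₂ (e , e∈E , x , inj₂ (inj₂ (trans rst≡ eq)))
  ...   | nothing = proj₂ f x q eq

  nextMemory : ∀ {e} → e ∈ E → F G → F G
  nextMemory {e} e∈E f = nextMemoryᶠ e (proj₁ f) , nextMemory-InK e∈E f

  nextMemory-MemUpd : ∀ {e} (e∈E : e ∈ E) (f : F G) x →
    MemUpd G (flow (tgt e) x) (rst e x) (proj₁ f x) (proj₁ (nextMemory e∈E f) x)
  nextMemory-MemUpd {e} e∈E f x with stopwatch (tgt e) x
  ... | inj₁ fl≡0 = (λ fl≡1 → contradiction (trans (sym fl≡1) fl≡0) 1≢0) , (λ _ → refl)
  ... | inj₂ fl≡1 = (λ _ → refl) , (λ fl≡0 → contradiction (trans (sym fl≡1) fl≡0) 1≢0)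

  liftEdge : ∀ l l' {a φ r} (f f' : F G) → mkEdge l a φ r l' ∈ E →
    (∀ x → MemUpd G (flow l' x) (r x) (proj₁ f x) (proj₁ f' x)) →
    Game.Edg (overline G) (attach G l f) a φ r (attach G l' f')
  liftEdge (inj₁ _) (inj₁ _) _ _ e∈E upd = e∈E , upd
  liftEdge (inj₁ _) (inj₂ _) _ _ e∈E upd = e∈E , upd
  liftEdge (inj₂ _) (inj₁ _) _ _ e∈E upd = e∈E , upd
  liftEdge (inj₂ _) (inj₂ _) _ _ e∈E upd = e∈E , upd

  module _ (ℝ : RealLike) where
    open Semantics ℝ

    liftStep : ∀ l (f : F G) {v m l' v'} → Step (toGame G) (l , v) m (l' , v') →
      Σ (F G) λ f' → Step (overline G) (attach G l f , v) m (attach G l' f' , v')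
    liftStep (inj₁ l) f {l' = l'} (φ , r , e∈E , guard-ok , v'≡) =
      nextMemory e∈E f , φ , r , liftEdge (inj₁ l) l' f _ e∈E (nextMemory-MemUpd e∈E f) , guard-ok , v'≡
    liftStep (inj₂ l) f {l' = l'} (φ , r , e∈E , guard-ok , v'≡) =
      nextMemory e∈E f , φ , r , liftEdge (inj₂ l) l' f _ e∈E (nextMemory-MemUpd e∈E f) , guard-ok , v'≡

    projectStep : ∀ {l̄ w m l̄' w'} → Step (overline G) (l̄ , w) m (l̄' , w') →
      Step (toGame G) (base G l̄ , w) m (base G l̄' , w')
    projectStep (φ , r , (e∈E , _) , guard-ok , w'≡) = φ , r , e∈E , guard-ok , w'≡

    β₁-base : ∀ l̄ w → β₁ G ℝ (base G l̄ , w) (l̄ , w)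
    β₁-base (inj₁ (_ , f)) w = f , refl , refl
    β₁-base (inj₂ (_ , f)) w = f , refl , refl

    β₁-copy : ∀ l (f : F G) {v} m p' → Step (toGame G) (l , v) m p' →
      Σ (Move (overline G)) λ m' → Σ (Conf (overline G)) λ q' →
        Step (overline G) (attach G l f , v) m' q' × β₁ G ℝ p' q'
    β₁-copy l f {v} m (l' , v') step with liftStep l f {v} {m} {l'} {v'} step
    ... | f' , step' = m , (attach G l' f' , v') , step' , (f' , refl , refl)

    β₁-project : ∀ l̄ {w} m q' → Step (overline G) (l̄ , w) m q' →
      Σ (Move (toGame G)) λ m' → Σ (Conf (toGame G)) λ p' →
        Step (toGame G) (base G l̄ , w) m' p' × β₁ G ℝ p' q'
    β₁-project l̄ {w} m (l̄' , w') step =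
      m , (base G l̄' , w') , projectStep {l̄} {w} {m} {l̄'} {w'} step , β₁-base l̄' w'

    β₁-isSimulation : IsSimulation (toGame G) (overline G) (β₁ G ℝ)
    β₁-isSimulation (inj₁ l , v) _ (f , refl , refl) =
      inj₁ (tt , tt) , refl , (λ _ → β₁-copy (inj₁ l) f) , λ ()
    β₁-isSimulation (inj₂ l , v) _ (f , refl , refl) =
      inj₂ (tt , tt) , refl , (λ ()) , (λ _ → β₁-project (inj₂ (l , f)))

lemma5 : (ℝ : RealLike) → {nX nA nO : ℕ} → (G : FinGame nX nA nO) →
    GuardsCompact G → IsInitialized G → IsStopwatch G →
    Semantics.Witnesses ℝ (toGame G) (overline G) (β₁ G ℝ)
lemma5 ℝ G _ _ stopwatch = β₁-isSimulation G stopwatch ℝ , (f₀ G , refl , refl)
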